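{- Let $T$ be a rooted tree and $v$ a vertex of $T$. A vertex $u$ is the level successor of $v$ if and only if $u$ is the vertex at the first position after the last occurrence of $v$ in the Euler tour of $T$ whose vertex $w$ satisfies $\mathrm{level}(w)\ge\mathrm{level}(v)$.
   Context: The level of the root $r$ is $0$, and the level of any other vertex is one more than the level of its parent. The Euler tour of $T$ is defined as follows. Replace each tree edge by the two opposite arcs parent$\to$child and child$\to$parent. The tour is the closed walk from $r$ back to $r$ that traverses each arc exactly once, namely the depth-first traversal. It is written as the sequence of visited vertices, with repetitions. The level successor of $v$ is the next vertex after $v$ in preorder (the order of first visits in this traversal) that has the same level as $v$. -}

module Defs where

open import Data.Nat using (ℕ; zero; suc; _≤_; _<_)
open import Data.List using (List; []; _∷_; _++_; map; length; lookup)
open import Data.Fin as Fin using (Fin)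
open import Data.Product using (Σ; _×_)
open import Data.List.Membership.Propositional using (_∈_)
open import Relation.Binary.PropositionalEquality using (_≡_; _≢_)

-- A rooted (ordered) tree: a root with an ordered list of subtrees.
-- The child order fixes the depth-first traversal.
data Tree : Set where
  node : List Tree → Tree

-- Vertices are named by their address: the list of child indices on the
-- path from the root (the root is []).
Vertex : Set
Vertex = List ℕ

level : Vertex → ℕ
level = length

mutual
  preorder : Tree → List Vertex
  preorder (node ts) = [] ∷ preorderF 0 ts

  preorderF : ℕ → List Tree → List Vertex
  preorderF i [] = []
  preorderF i (t ∷ ts) = map (i ∷_) (preorder t) ++ preorderF (suc i) ts

mutual
  -- Euler tour: closed walk from the root traversing each arc once,
  -- written as the sequence of visited vertices (with repetitions).
  euler : Tree → List Vertex
  euler (node ts) = [] ∷ eulerF 0 ts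

  eulerF : ℕ → List Tree → List Vertex
  eulerF i [] = []
  eulerF i (t ∷ ts) = map (i ∷_) (euler t) ++ ([] ∷ eulerF (suc i) ts)

IsVertex : Tree → Vertex → Set
IsVertex T v = v ∈ preorder T

LevelSuccessor : Tree → Vertex → Vertex → Set
LevelSuccessor T v u =
  Σ (Fin (length P)) λ i → Σ (Fin (length P)) λ j →
    lookup P i ≡ v × Fin._<_ i j × lookup P j ≡ u × level u ≡ level v ×
    (∀ k → Fin._<_ i k → Fin._<_ k j → level (lookup P k) ≢ level v)
  where P = preorder T

EulerTourCharacterisation : Tree → Vertex → Vertex → Set
EulerTourCharacterisation T v u =
  Σ (Fin (length E)) λ i → Σ (Fin (length E)) λ j →
    lookup E i ≡ v × (∀ k → Fin._<_ i k → lookup E k ≢ v) ×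
    Fin._<_ i j × lookup E j ≡ u × level v ≤ level u ×
    (∀ k → Fin._<_ i k → Fin._<_ k j → level (lookup E k) < level v)
  where E = euler T

-- Along the Euler tour the level changes by one at each step and increases only when a vertex
-- is visited for the first time, so the first vertex of level ≥ n in the tour of a tree is the
-- first vertex of level n in its preorder. After the last visit of v the tour runs through the
-- subtrees to the right of v and of its ancestors, which are exactly what preorder lists after
-- the subtree of v, and the subtree of v itself lies strictly below the level of v. Hence the
-- first vertex of level ≥ level v after the last v in the tour is the first vertex of level
-- exactly level v after v in preorder.

module Submission where

open import Defs
open import Level using (Level; _⊔_)
open import Function.Base using (_∘_; flip)
open import Function.Bundles using (_⇔_; mk⇔; Equivalence)
import Function.Properties.Equivalence as ⇔
open import Data.Bool using (true; false; if_then_else_)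
open import Data.Nat using (ℕ; zero; suc; _≤_; z≤n; s≤s; s≤s⁻¹)
open import Data.Nat.Properties using (_≤?_; _≟_; ≤-refl; <⇒≤; suc-injective; 1+n≰n; ≰⇒>; <⇒≱)
open import Data.Fin as Fin using (Fin; zero; suc; toℕ)
open import Data.Maybe as Maybe using (Maybe; just; nothing; _<∣>_)
open import Data.List using (List; []; _∷_; _++_; map; length; lookup; drop; find)
open import Data.List.Properties using (≡-dec; ∷-injectiveʳ; map-++; ++-assoc)
open import Data.List.Membership.Propositional using (_∈_; _∉_)
open import Data.List.Membership.Propositional.Properties
  using (∈-map⁺; ∈-map⁻; ∈-++⁺ˡ; ∈-++⁺ʳ; ∈-++⁻; ∈-lookup)
open import Data.List.Relation.Unary.Any using (here; there; index)
open import Data.List.Relation.Unary.Any.Properties using (lookup-index)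
import Data.List.Relation.Unary.All as All
open import Data.List.Relation.Unary.AllPairs using ([]; _∷_)
open import Data.List.Relation.Unary.Unique.Propositional using (Unique)
import Data.List.Relation.Unary.Unique.Propositional.Properties as Unique
open import Data.Product using (Σ-syntax; ∃; ∃₂; _×_; _,_; proj₁; proj₂)
open import Data.Sum using (inj₁; inj₂)
open import Relation.Nullary using (¬_; Dec; yes; no; does; contradiction)
open import Relation.Nullary.Decidable using (does-⇔)
open import Relation.Unary using (Pred; Decidable)
open import Relation.Binary.Definitions using (DecidableEquality)
open import Relation.Binary.PropositionalEquality
  using (_≡_; _≢_; refl; sym; trans; cong; cong₂; subst)
open Relation.Binary.PropositionalEquality.≡-Reasoning

private
  variable
    a b p q : Level

module _ {A : Set a} {P : Pred A p} (P? : Decidable P) where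

  private
    variable
      x : A
      xs L : List A

  find-reject : ¬ P x → find P? (x ∷ xs) ≡ find P? xs
  find-reject {x = x} ¬px with P? x
  ... | yes px = contradiction px ¬px
  ... | no _ = refl

  find-none : (∀ {x} → x ∈ L → ¬ P x) → find P? L ≡ nothing
  find-none {L = []} _ = refl
  find-none {L = x ∷ L} none =
    trans (find-reject {xs = L} (none (here refl))) (find-none (none ∘ there))

  find-++ : ∀ X Y → find P? (X ++ Y) ≡ find P? X <∣> find P? Y
  find-++ [] Y = refl
  find-++ (x ∷ X) Y with does (P? x)
  ... | true = refl
  ... | false = find-++ X Y

  find-map : ∀ {B : Set b} (f : B → A) L → find P? (map f L) ≡ Maybe.map f (find (P? ∘ f) L)
  find-map f [] = refl
  find-map f (x ∷ L) with does (P? (f x))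
  ... | true = refl
  ... | false = find-map f L

find-cong : {A : Set a} {P : Pred A p} {Q : Pred A q} (P? : Decidable P) (Q? : Decidable Q) →
            (∀ {x} → P x ⇔ Q x) → ∀ L → find P? L ≡ find Q? L
find-cong P? Q? P⇔Q [] = refl
find-cong P? Q? P⇔Q (x ∷ L) rewrite does-⇔ P⇔Q (P? x) (Q? x) =
  cong (if_then_else_ (does (Q? x)) (just x)) (find-cong P? Q? P⇔Q L)

FirstIn : {A : Set a} → Pred A p → (L : List A) → A → Set (a ⊔ p)
FirstIn P L u =
  Σ[ j ∈ Fin (length L) ] lookup L j ≡ u × P u × (∀ k → k Fin.< j → ¬ P (lookup L k))

FirstAfter : {A : Set a} → Pred A p → (L : List A) → Fin (length L) → A → Set (a ⊔ p)
FirstAfter P L i u =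
  Σ[ j ∈ Fin (length L) ] i Fin.< j × lookup L j ≡ u × P u ×
    (∀ k → i Fin.< k → k Fin.< j → ¬ P (lookup L k))

module _ {A : Set a} {P : Pred A p} where

  FirstIn-∷ : ∀ {x xs u} → ¬ P x → FirstIn P xs u ⇔ FirstIn P (x ∷ xs) u
  FirstIn-∷ {x} {xs} {u} ¬px = mk⇔ to from
    where
    to : FirstIn P xs u → FirstIn P (x ∷ xs) u
    to (j , uⱼ , pu , before) = suc j , uⱼ , pu , λ where
      zero _ → ¬px
      (suc k) (s≤s k<j) → before k k<j
    from : FirstIn P (x ∷ xs) u → FirstIn P xs u
    from (zero , refl , pu , _) = contradiction pu ¬px
    from (suc j , uⱼ , pu , before) = j , uⱼ , pu , λ k k<j → before (suc k) (s≤s k<j)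

  FirstIn⇔FirstAfter-head : ∀ {x xs u} → FirstIn P xs u ⇔ FirstAfter P (x ∷ xs) zero u
  FirstIn⇔FirstAfter-head {x} {xs} {u} = mk⇔ to from
    where
    to : FirstIn P xs u → FirstAfter P (x ∷ xs) zero u
    to (j , uⱼ , pu , before) = suc j , s≤s z≤n , uⱼ , pu , λ where
      (suc k) _ (s≤s k<j) → before k k<j
    from : FirstAfter P (x ∷ xs) zero u → FirstIn P xs u
    from (suc j , _ , uⱼ , pu , between) =
      j , uⱼ , pu , λ k k<j → between (suc k) (s≤s z≤n) (s≤s k<j)

  FirstAfter-∷ : ∀ {x xs i u} → FirstAfter P xs i u ⇔ FirstAfter P (x ∷ xs) (suc i) u
  FirstAfter-∷ {x} {xs} {i} {u} = mk⇔ to from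
    where
    to : FirstAfter P xs i u → FirstAfter P (x ∷ xs) (suc i) u
    to (j , i<j , uⱼ , pu , between) = suc j , s≤s i<j , uⱼ , pu , λ where
      (suc k) (s≤s i<k) (s≤s k<j) → between k i<k k<j
    from : FirstAfter P (x ∷ xs) (suc i) u → FirstAfter P xs i u
    from (suc j , s≤s i<j , uⱼ , pu , between) =
      j , i<j , uⱼ , pu , λ k i<k k<j → between (suc k) (s≤s i<k) (s≤s k<j)

  module _ (P? : Decidable P) where

    find⇔FirstIn : ∀ {u} L → find P? L ≡ just u ⇔ FirstIn P L u
    find⇔FirstIn [] = mk⇔ (λ ()) (λ ())
    find⇔FirstIn {u} (x ∷ L) with P? x
    ... | no ¬px = ⇔.trans (find⇔FirstIn L) (FirstIn-∷ ¬px)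
    ... | yes px = mk⇔ to from
      where
      to : just x ≡ just u → FirstIn P (x ∷ L) u
      to refl = zero , refl , px , λ _ ()
      from : FirstIn P (x ∷ L) u → just x ≡ just u
      from (zero , refl , _ , _) = refl
      from (suc _ , _ , _ , before) = contradiction px (before zero (s≤s z≤n))

    find-drop⇔FirstAfter : ∀ {u} L (i : Fin (length L)) →
                           find P? (drop (suc (toℕ i)) L) ≡ just u ⇔ FirstAfter P L i u
    find-drop⇔FirstAfter (x ∷ L) zero = ⇔.trans (find⇔FirstIn L) FirstIn⇔FirstAfter-head
    find-drop⇔FirstAfter (x ∷ L) (suc i) = ⇔.trans (find-drop⇔FirstAfter L i) FirstAfter-∷

LastOccurrence : {A : Set a} (L : List A) → Fin (length L) → A → Set a
LastOccurrence L i v = lookup L i ≡ v × (∀ k → i Fin.< k → lookup L k ≢ v)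

Unique⇒LastOccurrence : {A : Set a} {L : List A} {i : Fin (length L)} {v : A} →
                        Unique L → lookup L i ≡ v → LastOccurrence L i v
Unique⇒LastOccurrence {L = x ∷ xs} {zero} (x∉xs ∷ _) refl =
  refl , λ where (suc k) _ xₖ≡x → All.lookup x∉xs (∈-lookup k) (sym xₖ≡x)
Unique⇒LastOccurrence {L = x ∷ xs} {suc i} (_ ∷ unique) vᵢ
  with Unique⇒LastOccurrence unique vᵢ
... | _ , later = vᵢ , λ where (suc k) (s≤s i<k) → later k i<k

module AfterLast {A : Set a} (_≟_ : DecidableEquality A) where

  open import Data.List.Membership.DecPropositional _≟_ using (_∈?_)

  private
    variable
      x u v : A
      xs L Y : List A

  -- If v ∉ xs then x is the last occurrence of v, unless v ∉ x ∷ xs (a junk case).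
  afterLast : A → List A → List A
  afterLast v [] = []
  afterLast v (x ∷ xs) with v ∈? xs
  ... | yes _ = afterLast v xs
  ... | no _ = xs

  afterLast-∷-∈ : ∀ x → v ∈ xs → afterLast v (x ∷ xs) ≡ afterLast v xs
  afterLast-∷-∈ {v = v} {xs = xs} _ v∈xs with v ∈? xs
  ... | yes _ = refl
  ... | no v∉xs = contradiction v∈xs v∉xs

  afterLast-∷-∉ : ∀ x → v ∉ xs → afterLast v (x ∷ xs) ≡ xs
  afterLast-∷-∉ {v = v} {xs = xs} _ v∉xs with v ∈? xs
  ... | yes v∈xs = contradiction v∈xs v∉xs
  ... | no _ = refl

  afterLast-++ʳ : ∀ X → v ∈ Y → afterLast v (X ++ Y) ≡ afterLast v Y
  afterLast-++ʳ [] v∈Y = refl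
  afterLast-++ʳ (x ∷ X) v∈Y = trans (afterLast-∷-∈ x (∈-++⁺ʳ X v∈Y)) (afterLast-++ʳ X v∈Y)

  afterLast-split : ∀ X → v ∉ Y → afterLast v (X ++ v ∷ Y) ≡ Y
  afterLast-split {v = v} X v∉Y = trans (afterLast-++ʳ X (here refl)) (afterLast-∷-∉ v v∉Y)

  ∈⇒lastSplit : v ∈ L → ∃₂ λ X Y → L ≡ X ++ v ∷ Y × v ∉ Y
  ∈⇒lastSplit {v = v} {L = x ∷ xs} v∈L with v ∈? xs | v∈L
  ... | yes v∈xs | _ with ∈⇒lastSplit v∈xs
  ...   | X , Y , xs≡ , v∉Y = x ∷ X , Y , cong (x ∷_) xs≡ , v∉Y
  ∈⇒lastSplit {L = x ∷ xs} v∈L | no v∉xs | here refl = [] , xs , refl , v∉xs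
  ∈⇒lastSplit {L = x ∷ xs} v∈L | no v∉xs | there v∈xs = contradiction v∈xs v∉xs

  ∈⇒LastOccurrence : v ∈ L → ∃ λ i → LastOccurrence L i v
  ∈⇒LastOccurrence {v = v} {L = x ∷ xs} v∈L with v ∈? xs | v∈L
  ... | yes v∈xs | _ with ∈⇒LastOccurrence v∈xs
  ...   | i , vᵢ , later = suc i , vᵢ , λ where (suc k) (s≤s i<k) → later k i<k
  ∈⇒LastOccurrence {L = x ∷ xs} v∈L | no v∉xs | here refl =
    zero , refl , λ where (suc k) _ xₖ≡v → v∉xs (subst (_∈ xs) xₖ≡v (∈-lookup k))
  ∈⇒LastOccurrence {L = x ∷ xs} v∈L | no v∉xs | there v∈xs = contradiction v∈xs v∉xs

  LastOccurrence⇒afterLast≡drop : ∀ L i → LastOccurrence L i v →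
                                   afterLast v L ≡ drop (suc (toℕ i)) L
  LastOccurrence⇒afterLast≡drop (x ∷ xs) zero (_ , later) =
    afterLast-∷-∉ x λ v∈xs → later (suc (index v∈xs)) (s≤s z≤n) (sym (lookup-index v∈xs))
  LastOccurrence⇒afterLast≡drop (x ∷ xs) (suc i) (vᵢ , later) =
    trans (afterLast-∷-∈ x (subst (_∈ xs) vᵢ (∈-lookup i)))
          (LastOccurrence⇒afterLast≡drop xs i (vᵢ , λ k i<k → later (suc k) (s≤s i<k)))

  find-afterLast⇔FirstAfter : ∀ {P : Pred A p} (P? : Decidable P) L {i} →
                              LastOccurrence L i v →
                              find P? (afterLast v L) ≡ just u ⇔ FirstAfter P L i u
  find-afterLast⇔FirstAfter P? L {i} last
    rewrite LastOccurrence⇒afterLast≡drop L i last = find-drop⇔FirstAfter P? L i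

_≟ᵥ_ : DecidableEquality Vertex
_≟ᵥ_ = ≡-dec _≟_

open AfterLast _≟ᵥ_

mutual
  preorder⊆euler : ∀ t {w} → w ∈ preorder t → w ∈ euler t
  preorder⊆euler (node ts) (here w≡root) = here w≡root
  preorder⊆euler (node ts) (there w∈) = there (preorderF⊆eulerF 0 ts w∈)

  preorderF⊆eulerF : ∀ i ts {w} → w ∈ preorderF i ts → w ∈ eulerF i ts
  preorderF⊆eulerF i (t ∷ ts) w∈ with ∈-++⁻ (map (i ∷_) (preorder t)) w∈
  ... | inj₂ w∈rest = ∈-++⁺ʳ (map (i ∷_) (euler t)) (there (preorderF⊆eulerF (suc i) ts w∈rest))
  ... | inj₁ w∈child with ∈-map⁻ (i ∷_) w∈child
  ...   | _ , x∈t , refl = ∈-++⁺ˡ (∈-map⁺ (i ∷_) (preorder⊆euler t x∈t))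

eulerF-head≥ : ∀ i ts {c w} → (c ∷ w) ∈ eulerF i ts → i ≤ c
eulerF-head≥ i (t ∷ ts) w∈ with ∈-++⁻ (map (i ∷_) (euler t)) w∈
... | inj₂ (there w∈rest) = <⇒≤ (eulerF-head≥ (suc i) ts w∈rest)
... | inj₁ w∈child with ∈-map⁻ (i ∷_) w∈child
...   | _ , _ , refl = ≤-refl

∷∉eulerF-suc : ∀ i ts {w} → (i ∷ w) ∉ eulerF (suc i) ts
∷∉eulerF-suc i ts = 1+n≰n ∘ eulerF-head≥ (suc i) ts

[]∉preorderF : ∀ i ts → [] ∉ preorderF i ts
[]∉preorderF i (t ∷ ts) []∈ with ∈-++⁻ (map (i ∷_) (preorder t)) []∈
... | inj₂ []∈rest = []∉preorderF (suc i) ts []∈rest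
... | inj₁ []∈child with ∈-map⁻ (i ∷_) []∈child
...   | _ , _ , ()

mutual
  preorder-unique : ∀ t → Unique (preorder t)
  preorder-unique (node ts) =
    All.tabulate (λ { w∈ refl → []∉preorderF 0 ts w∈ }) ∷ preorderF-unique 0 ts

  preorderF-unique : ∀ i ts → Unique (preorderF i ts)
  preorderF-unique i [] = []
  preorderF-unique i (t ∷ ts) =
    Unique.++⁺ (Unique.map⁺ ∷-injectiveʳ (preorder-unique t)) (preorderF-unique (suc i) ts) disjoint
    where
    disjoint : ∀ {w} → ¬ (w ∈ map (i ∷_) (preorder t) × w ∈ preorderF (suc i) ts)
    disjoint (w∈child , w∈rest) with ∈-map⁻ (i ∷_) w∈child
    ... | _ , _ , refl = ∷∉eulerF-suc i ts (preorderF⊆eulerF (suc i) ts w∈rest)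

afterLast-root-euler : ∀ i ts → afterLast [] ([] ∷ eulerF i ts) ≡ []
afterLast-root-euler i [] = afterLast-∷-∉ {v = []} [] λ ()
afterLast-root-euler i (t ∷ ts) =
  trans (afterLast-++ʳ ([] ∷ map (i ∷_) (euler t)) (here refl)) (afterLast-root-euler (suc i) ts)

afterLast-child : ∀ {i x} {xs ys : List Vertex} → x ∈ xs → (i ∷ x) ∉ ys →
                  afterLast (i ∷ x) (map (i ∷_) xs ++ ys) ≡ map (i ∷_) (afterLast x xs) ++ ys
afterLast-child {i} {x} {ys = ys} x∈xs i∷x∉ys with ∈⇒lastSplit x∈xs
... | X , Y , refl , x∉Y = begin
  afterLast (i ∷ x) (map (i ∷_) (X ++ x ∷ Y) ++ ys)
    ≡⟨ cong (afterLast (i ∷ x)) regroup ⟩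
  afterLast (i ∷ x) (map (i ∷_) X ++ (i ∷ x) ∷ map (i ∷_) Y ++ ys)
    ≡⟨ afterLast-split (map (i ∷_) X) i∷x∉ ⟩
  map (i ∷_) Y ++ ys
    ≡⟨ cong (λ zs → map (i ∷_) zs ++ ys) (afterLast-split X x∉Y) ⟨
  map (i ∷_) (afterLast x (X ++ x ∷ Y)) ++ ys ∎
  where
  regroup : map (i ∷_) (X ++ x ∷ Y) ++ ys ≡ map (i ∷_) X ++ (i ∷ x) ∷ map (i ∷_) Y ++ ys
  regroup = trans (cong (_++ ys) (map-++ (i ∷_) X (x ∷ Y))) (++-assoc (map (i ∷_) X) _ ys)
  i∷x∉ : (i ∷ x) ∉ map (i ∷_) Y ++ ys
  i∷x∉ i∷x∈ with ∈-++⁻ (map (i ∷_) Y) i∷x∈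
  ... | inj₂ i∷x∈ys = i∷x∉ys i∷x∈ys
  ... | inj₁ i∷x∈Y with ∈-map⁻ (i ∷_) i∷x∈Y
  ...   | _ , x∈Y , refl = x∉Y x∈Y

level≥? : ∀ n → Decidable (λ w → n ≤ level w)
level≥? n w = n ≤? level w

level≡? : ∀ n → Decidable (λ w → level w ≡ n)
level≡? n w = level w ≟ n

module FindChild {r} {R : ℕ → ℕ → Set r} (R? : ∀ m n → Dec (R m n))
                 (R-suc : ∀ {m n} → R (suc m) (suc n) ⇔ R m n)
                 (R-root : ∀ {m} → ¬ R (suc m) zero) where

  find-root : ∀ m (ws : List Vertex) →
              find (R? (suc m) ∘ level) ([] ∷ ws) ≡ find (R? (suc m) ∘ level) ws
  find-root m ws = find-reject (R? (suc m) ∘ level) {x = []} {xs = ws} R-root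

  find-child-++ : ∀ m i (xs ys : List Vertex) →
                  find (R? (suc m) ∘ level) (map (i ∷_) xs ++ ys) ≡
                  Maybe.map (i ∷_) (find (R? m ∘ level) xs) <∣> find (R? (suc m) ∘ level) ys
  find-child-++ m i xs ys =
    trans (find-++ _ (map (i ∷_) xs) ys)
          (cong (_<∣> _) (trans (find-map _ (i ∷_) xs)
                                (cong (Maybe.map (i ∷_)) (find-cong _ _ R-suc xs))))

open FindChild _≤?_ (mk⇔ s≤s⁻¹ s≤s) (λ ()) using ()
  renaming (find-root to find-level≥-root; find-child-++ to find-level≥-child-++)
open FindChild (flip _≟_) (mk⇔ suc-injective (cong suc)) (λ ()) using ()
  renaming (find-root to find-level≡-root; find-child-++ to find-level≡-child-++)

mutual
  find-euler≡find-preorder : ∀ n t → find (level≥? n) (euler t) ≡ find (level≡? n) (preorder t)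
  find-euler≡find-preorder zero (node ts) = refl
  find-euler≡find-preorder (suc n) (node ts) = begin
    find (level≥? (suc n)) ([] ∷ eulerF 0 ts)   ≡⟨ find-level≥-root n (eulerF 0 ts) ⟩
    find (level≥? (suc n)) (eulerF 0 ts)        ≡⟨ find-eulerF≡find-preorderF n 0 ts ⟩
    find (level≡? (suc n)) (preorderF 0 ts)     ≡⟨ find-level≡-root n (preorderF 0 ts) ⟨
    find (level≡? (suc n)) ([] ∷ preorderF 0 ts) ∎

  find-eulerF≡find-preorderF : ∀ n i ts → find (level≥? (suc n)) (eulerF i ts) ≡
                                           find (level≡? (suc n)) (preorderF i ts)
  find-eulerF≡find-preorderF n i [] = refl
  find-eulerF≡find-preorderF n i (t ∷ ts) = begin
    find (level≥? (suc n)) (map (i ∷_) (euler t) ++ [] ∷ eulerF (suc i) ts)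
      ≡⟨ find-level≥-child-++ n i (euler t) ([] ∷ eulerF (suc i) ts) ⟩
    Maybe.map (i ∷_) (find (level≥? n) (euler t)) <∣>
    find (level≥? (suc n)) ([] ∷ eulerF (suc i) ts)
      ≡⟨ cong₂ _<∣>_ (cong (Maybe.map (i ∷_)) (find-euler≡find-preorder n t))
                     (trans (find-level≥-root n (eulerF (suc i) ts))
                            (find-eulerF≡find-preorderF n (suc i) ts)) ⟩
    Maybe.map (i ∷_) (find (level≡? n) (preorder t)) <∣>
    find (level≡? (suc n)) (preorderF (suc i) ts)
      ≡⟨ find-level≡-child-++ n i (preorder t) (preorderF (suc i) ts) ⟨
    find (level≡? (suc n)) (map (i ∷_) (preorder t) ++ preorderF (suc i) ts) ∎

mutual
  find-afterLast-euler≡preorder :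
    ∀ t {v} → v ∈ preorder t →
    find (level≥? (level v)) (afterLast v (euler t)) ≡
    find (level≡? (level v)) (afterLast v (preorder t))
  find-afterLast-euler≡preorder (node ts) (here refl) = begin
    find (level≥? 0) (afterLast [] ([] ∷ eulerF 0 ts))
      ≡⟨ cong (find _) (afterLast-root-euler 0 ts) ⟩
    nothing
      ≡⟨ find-none _ nonroot ⟨
    find (level≡? 0) (preorderF 0 ts)
      ≡⟨ cong (find _) (afterLast-∷-∉ [] ([]∉preorderF 0 ts)) ⟨
    find (level≡? 0) (afterLast [] ([] ∷ preorderF 0 ts)) ∎
    where
    nonroot : ∀ {w} → w ∈ preorderF 0 ts → level w ≢ 0
    nonroot {[]} []∈ _ = []∉preorderF 0 ts []∈
  find-afterLast-euler≡preorder (node ts) {v} (there v∈) = begin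
    find (level≥? (level v)) (afterLast v ([] ∷ eulerF 0 ts))
      ≡⟨ cong (find _) (afterLast-∷-∈ [] (preorderF⊆eulerF 0 ts v∈)) ⟩
    find (level≥? (level v)) (afterLast v (eulerF 0 ts))
      ≡⟨ find-afterLast-eulerF≡preorderF 0 ts v∈ ⟩
    find (level≡? (level v)) (afterLast v (preorderF 0 ts))
      ≡⟨ cong (find _) (afterLast-∷-∈ [] v∈) ⟨
    find (level≡? (level v)) (afterLast v ([] ∷ preorderF 0 ts)) ∎

  find-afterLast-eulerF≡preorderF :
    ∀ i ts {v} → v ∈ preorderF i ts →
    find (level≥? (level v)) (afterLast v (eulerF i ts)) ≡
    find (level≡? (level v)) (afterLast v (preorderF i ts))
  find-afterLast-eulerF≡preorderF i (t ∷ ts) {v} v∈ with ∈-++⁻ (map (i ∷_) (preorder t)) v∈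
  ... | inj₂ v∈rest = begin
    find (level≥? (level v)) (afterLast v (map (i ∷_) (euler t) ++ [] ∷ eulerF (suc i) ts))
      ≡⟨ cong (find _) (trans (afterLast-++ʳ (map (i ∷_) (euler t)) (there v∈restᴱ))
                              (afterLast-∷-∈ [] v∈restᴱ)) ⟩
    find (level≥? (level v)) (afterLast v (eulerF (suc i) ts))
      ≡⟨ find-afterLast-eulerF≡preorderF (suc i) ts v∈rest ⟩
    find (level≡? (level v)) (afterLast v (preorderF (suc i) ts))
      ≡⟨ cong (find _) (afterLast-++ʳ (map (i ∷_) (preorder t)) v∈rest) ⟨
    find (level≡? (level v)) (afterLast v (map (i ∷_) (preorder t) ++ preorderF (suc i) ts)) ∎
    where
    v∈restᴱ : v ∈ eulerF (suc i) ts
    v∈restᴱ = preorderF⊆eulerF (suc i) ts v∈rest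
  ... | inj₁ v∈child with ∈-map⁻ (i ∷_) v∈child
  ...   | x , x∈t , refl = begin
    find (level≥? (suc n)) (afterLast (i ∷ x) (map (i ∷_) (euler t) ++ [] ∷ eulerF (suc i) ts))
      ≡⟨ cong (find _) (afterLast-child (preorder⊆euler t x∈t) i∷x∉ᴱ) ⟩
    find (level≥? (suc n)) (map (i ∷_) (afterLast x (euler t)) ++ [] ∷ eulerF (suc i) ts)
      ≡⟨ find-level≥-child-++ n i (afterLast x (euler t)) ([] ∷ eulerF (suc i) ts) ⟩
    Maybe.map (i ∷_) (find (level≥? n) (afterLast x (euler t))) <∣>
    find (level≥? (suc n)) ([] ∷ eulerF (suc i) ts)
      ≡⟨ cong₂ _<∣>_ (cong (Maybe.map (i ∷_)) (find-afterLast-euler≡preorder t x∈t))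
                     (trans (find-level≥-root n (eulerF (suc i) ts))
                            (find-eulerF≡find-preorderF n (suc i) ts)) ⟩
    Maybe.map (i ∷_) (find (level≡? n) (afterLast x (preorder t))) <∣>
    find (level≡? (suc n)) (preorderF (suc i) ts)
      ≡⟨ find-level≡-child-++ n i (afterLast x (preorder t)) (preorderF (suc i) ts) ⟨
    find (level≡? (suc n)) (map (i ∷_) (afterLast x (preorder t)) ++ preorderF (suc i) ts)
      ≡⟨ cong (find _) (afterLast-child x∈t (∷∉eulerF-suc i ts ∘ preorderF⊆eulerF (suc i) ts)) ⟨
    find (level≡? (suc n)) (afterLast (i ∷ x) (map (i ∷_) (preorder t) ++ preorderF (suc i) ts)) ∎
    where
    n : ℕ
    n = level x
    i∷x∉ᴱ : (i ∷ x) ∉ [] ∷ eulerF (suc i) ts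
    i∷x∉ᴱ (there i∷x∈) = ∷∉eulerF-suc i ts i∷x∈

FirstAfter-preorder⇔euler :
  ∀ T {v u i i′} → v ∈ preorder T →
  LastOccurrence (preorder T) i v → LastOccurrence (euler T) i′ v →
  FirstAfter (λ w → level w ≡ level v) (preorder T) i u ⇔
  FirstAfter (λ w → level v ≤ level w) (euler T) i′ u
FirstAfter-preorder⇔euler T {v} v∈T lastᴾ lastᴱ =
  ⇔.trans (⇔.sym (find-afterLast⇔FirstAfter (level≡? (level v)) (preorder T) lastᴾ))
          (⇔.trans (mk⇔ (trans core) (trans (sym core)))
                   (find-afterLast⇔FirstAfter (level≥? (level v)) (euler T) lastᴱ))
  where
  core : find (level≥? (level v)) (afterLast v (euler T)) ≡
         find (level≡? (level v)) (afterLast v (preorder T))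
  core = find-afterLast-euler≡preorder T v∈T

mainTheorem9 : (T : Tree) (v u : Vertex) → IsVertex T v →
    (LevelSuccessor T v u ⇔ EulerTourCharacterisation T v u)
mainTheorem9 T v u v∈T = mk⇔ to from
  where
  to : LevelSuccessor T v u → EulerTourCharacterisation T v u
  to (i , j , vᵢ , i<j , uⱼ , same , between) =
    let lastᴾ = Unique⇒LastOccurrence (preorder-unique T) vᵢ
        i′ , lastᴱ = ∈⇒LastOccurrence {L = euler T} (preorder⊆euler T v∈T)
        j′ , i′<j′ , uⱼ′ , deeper , between′ =
          Equivalence.to (FirstAfter-preorder⇔euler T v∈T lastᴾ lastᴱ)
            (j , i<j , uⱼ , same , between)
    in i′ , j′ , proj₁ lastᴱ , proj₂ lastᴱ , i′<j′ , uⱼ′ , deeper ,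
       λ k i′<k k<j′ → ≰⇒> (between′ k i′<k k<j′)

  from : EulerTourCharacterisation T v u → LevelSuccessor T v u
  from (i , j , vᵢ , later , i<j , uⱼ , deeper , between) =
    let i′ , lastᴾ = ∈⇒LastOccurrence {L = preorder T} v∈T
        j′ , i′<j′ , uⱼ′ , same , between′ =
          Equivalence.from (FirstAfter-preorder⇔euler T v∈T lastᴾ (vᵢ , later))
            (j , i<j , uⱼ , deeper , λ k i<k k<j → <⇒≱ (between k i<k k<j))
    in i′ , j′ , proj₁ lastᴾ , i′<j′ , uⱼ′ , same , between′
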